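{- Let $K$ be a field of characteristic zero and let $B\colon K[x]\to K[x]$ be a linear operator such that $\deg(Bp)+1=\deg p$ for every nonconstant polynomial $p$ and $Ba=0$ for every constant $a$. (1) For formal power series $f_k(t)\in K[[t]]$, the formal sum $\sum_{k=0}^\infty f_k(B)\,X^k$ converges in the discrete topology if and only if $\lim_{k\to\infty}[\operatorname{ord}(f_k)-k]=+\infty$. (2) For polynomials $a_k(x)\in K[x]$, the formal sum $\sum_{k=0}^\infty B^k\,a_k(X)$ converges in the discrete topology if and only if $\lim_{k\to\infty}[k-\deg(a_k)]=+\infty$.
   Context: $X$ is multiplication by $x$, $a(X)$ multiplication by $a(x)$, and $f(B)=\sum_jc_jB^j$ for $f=\sum_jc_jt^j$. $\operatorname{ord}(f)$ is the least $j$ with $c_j\neq 0$ ($\operatorname{ord}(0)=+\infty$); the zero polynomial has degree $-\infty$. Convergence in the discrete topology means that for every polynomial $p$, the partial sums applied to $p$ are eventually constant. -}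

module Defs where

open import Level using (Level; _⊔_)
open import Algebra.Bundles using (CommutativeRing)
open import Data.Nat using (ℕ; zero; suc; _<_; _≤_) renaming (_+_ to _+ℕ_)
open import Data.List using (List; []; _∷_; length)
open import Data.Product using (Σ; ∃; _×_; _,_)
open import Relation.Nullary using (¬_)

record Field (c ℓ : Level) : Set (Level.suc (c ⊔ ℓ)) where
  field
    commRing : CommutativeRing c ℓ
  open CommutativeRing commRing public
  field
    1≉0     : ¬ (1# ≈ 0#)
    inverse : ∀ x → ¬ (x ≈ 0#) → ∃ λ y → (x * y) ≈ 1#

module FieldDefs {c ℓ : Level} (K : Field c ℓ) where
  open Field K

  natK : ℕ → Carrier
  natK zero    = 0#
  natK (suc n) = 1# + natK n

  CharZero : Set ℓ
  CharZero = ∀ n → ¬ (natK (suc n) ≈ 0#)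

  -- Polynomials in K[x]: coefficient lists (constant term first);
  -- equality is coefficientwise (so trailing zeros are irrelevant).
  Poly : Set c
  Poly = List Carrier

  coeff : Poly → ℕ → Carrier
  coeff []       _       = 0#
  coeff (a ∷ p)  zero    = a
  coeff (a ∷ p)  (suc i) = coeff p i

  _≈ₚ_ : Poly → Poly → Set ℓ
  p ≈ₚ q = ∀ i → coeff p i ≈ coeff q i

  0ₚ : Poly
  0ₚ = []

  _+ₚ_ : Poly → Poly → Poly
  []      +ₚ q       = q
  (a ∷ p) +ₚ []      = a ∷ p
  (a ∷ p) +ₚ (b ∷ q) = (a + b) ∷ (p +ₚ q)

  _·ₚ_ : Carrier → Poly → Poly
  c ·ₚ []      = []
  c ·ₚ (a ∷ p) = (c * a) ∷ (c ·ₚ p)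

  X : Poly → Poly
  X p = 0# ∷ p

  -- polynomial product; a(X) is the operator p ↦ a * p
  _*ₚ_ : Poly → Poly → Poly
  []      *ₚ q = []
  (a ∷ p) *ₚ q = (a ·ₚ q) +ₚ X (p *ₚ q)

  mulOp : Poly → (Poly → Poly)
  mulOp a p = a *ₚ p

  iter : (Poly → Poly) → ℕ → Poly → Poly
  iter T zero    p = p
  iter T (suc n) p = T (iter T n p)

  HasDegree : Poly → ℕ → Set ℓ
  HasDegree p d = ¬ (coeff p d ≈ 0#) × (∀ i → d < i → coeff p i ≈ 0#)

  IsConstant : Poly → Set ℓ
  IsConstant p = ∀ i → 0 < i → coeff p i ≈ 0#

  record IsLinear (B : Poly → Poly) : Set (c ⊔ ℓ) where
    field
      cong  : ∀ {p q} → p ≈ₚ q → B p ≈ₚ B q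
      additive : ∀ p q → B (p +ₚ q) ≈ₚ (B p +ₚ B q)
      homogeneous : ∀ a p → B (a ·ₚ p) ≈ₚ (a ·ₚ B p)

  LowersDegree : (Poly → Poly) → Set (c ⊔ ℓ)
  LowersDegree B =
    (∀ p d → HasDegree p (suc d) → HasDegree (B p) d) ×
    (∀ p → IsConstant p → B p ≈ₚ 0ₚ)

  PowerSeries : Set c
  PowerSeries = ℕ → Carrier

  truncApply : PowerSeries → (Poly → Poly) → ℕ → Poly → Poly
  truncApply f B zero    p = 0ₚ
  truncApply f B (suc n) p = truncApply f B n p +ₚ (f n ·ₚ iter B n p)

  -- f(B) p = sum_j c_j B^j p.  For B as in the theorem, B^j p = 0 whenever
  -- j > deg p, in particular for j ≥ length p, so the (discretely convergent)
  -- series equals the finite sum over j < length p.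
  applySeries : PowerSeries → (Poly → Poly) → Poly → Poly
  applySeries f B p = truncApply f B (length p) p

  partialSum : (ℕ → Poly → Poly) → ℕ → Poly → Poly
  partialSum T zero    p = 0ₚ
  partialSum T (suc N) p = partialSum T N p +ₚ T N p

  ConvergesDiscrete : (ℕ → Poly → Poly) → Set (c ⊔ ℓ)
  ConvergesDiscrete T =
    ∀ p → ∃ λ N → ∀ M → N ≤ M → partialSum T M p ≈ₚ partialSum T N p

  -- ord(f) ≥ n  (i.e. c_i = 0 for all i < n; ord 0 = +∞)
  OrdAtLeast : PowerSeries → ℕ → Set ℓ
  OrdAtLeast f n = ∀ i → i < n → f i ≈ 0#

  OrdMinusIndexToInfinity : (ℕ → PowerSeries) → Set ℓ
  OrdMinusIndexToInfinity f =
    ∀ m → ∃ λ N → ∀ k → N ≤ k → OrdAtLeast (f k) (k +ℕ m)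

  -- lim_{k→∞} [k − deg(a_k)] = +∞ :
  -- for every m, eventually deg(a_k) ≤ k − m, i.e. coeff (a_k) i = 0
  -- whenever i > k − m (i.e. k < i + m); deg 0 = −∞.
  IndexMinusDegToInfinity : (ℕ → Poly) → Set ℓ
  IndexMinusDegToInfinity a =
    ∀ m → ∃ λ N → ∀ k → N ≤ k → ∀ i → k < i +ℕ m → coeff (a k) i ≈ 0#

-- Both parts reduce to the fact that a series of operators T_k converges
-- discretely iff, for every p, T_k p = 0 for all large k. Since B lowers the
-- degree by exactly one, B^j x^n has degree exactly n − j for j ≤ n, so the map
-- f ↦ f(B) x^n is triangular with nonzero diagonal: f(B) x^n = 0 iff
-- ord f > n, and likewise B^k q = 0 iff deg q < k. Testing the k-th term on
-- p = x^m turns eventual vanishing into ord(f_k) ≥ k + m, resp.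
-- deg(a_k) < k − m; conversely these bounds kill the k-th term on every p
-- with deg p < m by a degree count.
module Submission where

open import Defs
open import Level using (Level)
open import Data.Nat using (ℕ)
open import Data.Product using (_×_)
open import Function.Bundles using (_⇔_)

open import Data.Nat using (zero; suc; z≤n; s≤s; pred; _∸_; _≤_; _<_; _≤?_)
  renaming (_+_ to _+ℕ_)
open import Data.Nat.Properties
  using ( ≤-refl; ≤-trans; <⇒≤; ≰⇒>; ≤-<-trans; m≤n⇒m≤1+n; m<n⇒m<1+n
        ; m≤n⇒m<n∨m≡n; m<1+n⇒m<n∨m≡n; <-cmp; <-irrefl; +-suc
        ; m≤n+m; ≤-reflexive; +-monoˡ-≤; +-monoʳ-<; m+[n∸m]≡n; m∸n+n≡m; pred-mono-≤ )
  renaming (+-identityʳ to +ℕ-identityʳ; +-comm to +ℕ-comm)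
open import Data.Product using (_,_; ∃; proj₁; proj₂)
open import Data.Sum using (inj₁; inj₂)
open import Data.List using ([]; _∷_; length; take)
open import Data.Empty using (⊥-elim)
open import Relation.Nullary using (¬_; yes; no)
open import Relation.Binary.Definitions using (Tri; tri<; tri≈; tri>)
open import Relation.Binary.PropositionalEquality as ≡ using (_≡_)
open import Function.Base using (_∘_)
open import Function.Bundles using (mk⇔)
import Function.Properties.Equivalence as ⇔

pred≤⇒≤suc : ∀ m {n} → pred m ≤ n → m ≤ suc n
pred≤⇒≤suc zero    _   = z≤n
pred≤⇒≤suc (suc m) m≤n = s≤s m≤n

module Development {c ℓ : Level} (K : Field c ℓ) where
  open Field K hiding (zero)
  open FieldDefs K
  open import Algebra.Properties.Group +-group using (identityʳ-unique)
  open import Relation.Binary.Reasoning.Setoid setoid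

  +-≈0 : ∀ {x y} → x ≈ 0# → y ≈ 0# → (x + y) ≈ 0#
  +-≈0 x≈0 y≈0 = trans (+-cong x≈0 y≈0) (+-identityˡ 0#)

  *-≈0ˡ : ∀ {x} y → x ≈ 0# → (x * y) ≈ 0#
  *-≈0ˡ y x≈0 = trans (*-cong x≈0 refl) (zeroˡ y)

  *-≈0ʳ : ∀ x {y} → y ≈ 0# → (x * y) ≈ 0#
  *-≈0ʳ x y≈0 = trans (*-cong refl y≈0) (zeroʳ x)

  x*y≈0⇒x≈0 : ∀ x y → (x * y) ≈ 0# → ¬ (y ≈ 0#) → x ≈ 0#
  x*y≈0⇒x≈0 x y xy≈0 y≉0 with inverse y y≉0
  ... | y⁻¹ , yy⁻¹≈1 = begin
    x              ≈⟨ sym (*-identityʳ x) ⟩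
    x * 1#         ≈⟨ *-cong refl (sym yy⁻¹≈1) ⟩
    x * (y * y⁻¹)  ≈⟨ sym (*-assoc x y y⁻¹) ⟩
    (x * y) * y⁻¹  ≈⟨ *-≈0ˡ y⁻¹ xy≈0 ⟩
    0#             ∎

  coeff-+ₚ : ∀ p q i → coeff (p +ₚ q) i ≈ (coeff p i + coeff q i)
  coeff-+ₚ []      q       i       = sym (+-identityˡ _)
  coeff-+ₚ (a ∷ p) []      zero    = sym (+-identityʳ _)
  coeff-+ₚ (a ∷ p) []      (suc i) = sym (+-identityʳ _)
  coeff-+ₚ (a ∷ p) (b ∷ q) zero    = refl
  coeff-+ₚ (a ∷ p) (b ∷ q) (suc i) = coeff-+ₚ p q i

  coeff-·ₚ : ∀ a p i → coeff (a ·ₚ p) i ≈ (a * coeff p i)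
  coeff-·ₚ a []      i       = sym (zeroʳ a)
  coeff-·ₚ a (b ∷ p) zero    = refl
  coeff-·ₚ a (b ∷ p) (suc i) = coeff-·ₚ a p i

  DegreeBelow : Poly → ℕ → Set ℓ
  DegreeBelow q n = ∀ i → n ≤ i → coeff q i ≈ 0#

  degreeBelow-mono : ∀ q {m n} → m ≤ n → DegreeBelow q m → DegreeBelow q n
  degreeBelow-mono q m≤n q<m i n≤i = q<m i (≤-trans m≤n n≤i)

  degreeBelow-lower : ∀ q {n} → DegreeBelow q (suc n) → coeff q n ≈ 0# → DegreeBelow q n
  degreeBelow-lower q q<1+n qₙ≈0 i n≤i with m≤n⇒m<n∨m≡n n≤i
  ... | inj₁ n<i      = q<1+n i n<i
  ... | inj₂ ≡.refl   = qₙ≈0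

  degreeBelow-length : ∀ q → DegreeBelow q (length q)
  degreeBelow-length []      i       _         = refl
  degreeBelow-length (a ∷ q) (suc i) (s≤s l≤i) = degreeBelow-length q i l≤i

  monomial : ℕ → Poly
  monomial n = iter X n (1# ∷ [])

  coeff-monomial-< : ∀ n i → i < n → coeff (monomial n) i ≡ 0#
  coeff-monomial-< (suc n) zero    _         = ≡.refl
  coeff-monomial-< (suc n) (suc i) (s≤s i<n) = coeff-monomial-< n i i<n

  coeff-monomial-≡ : ∀ n → coeff (monomial n) n ≡ 1#
  coeff-monomial-≡ zero    = ≡.refl
  coeff-monomial-≡ (suc n) = coeff-monomial-≡ n

  monomial-degreeBelow : ∀ n → DegreeBelow (monomial n) (suc n)
  monomial-degreeBelow zero    (suc i) _         = refl
  monomial-degreeBelow (suc n) (suc i) (s≤s n<i) = monomial-degreeBelow n i n<i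

  monomial-hasDegree : ∀ n → HasDegree (monomial n) n
  monomial-hasDegree n =
    (λ xⁿₙ≈0 → 1≉0 (trans (sym (reflexive (coeff-monomial-≡ n))) xⁿₙ≈0)) , monomial-degreeBelow n

  length-monomial : ∀ n → length (monomial n) ≡ suc n
  length-monomial zero    = ≡.refl
  length-monomial (suc n) = ≡.cong suc (length-monomial n)

  length-iterX : ∀ k p → length (iter X k p) ≡ k +ℕ length p
  length-iterX zero    p = ≡.refl
  length-iterX (suc k) p = ≡.cong suc (length-iterX k p)

  iterX-monomial : ∀ k m → iter X k (monomial m) ≡ monomial (k +ℕ m)
  iterX-monomial zero    m = ≡.refl
  iterX-monomial (suc k) m = ≡.cong X (iterX-monomial k m)

  coeff-iterX : ∀ m q i → coeff (iter X m q) (m +ℕ i) ≡ coeff q i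
  coeff-iterX zero    q i = ≡.refl
  coeff-iterX (suc m) q i = coeff-iterX m q i

  coeff-take-< : ∀ t q i → i < t → coeff (take t q) i ≡ coeff q i
  coeff-take-< (suc t) []      i       _         = ≡.refl
  coeff-take-< (suc t) (a ∷ q) zero    _         = ≡.refl
  coeff-take-< (suc t) (a ∷ q) (suc i) (s≤s i<t) = coeff-take-< t q i i<t

  take-degreeBelow : ∀ t q → DegreeBelow (take t q) t
  take-degreeBelow zero    q       i       _         = refl
  take-degreeBelow (suc t) []      i       _         = refl
  take-degreeBelow (suc t) (a ∷ q) (suc i) (s≤s t≤i) = take-degreeBelow t q i t≤i

  split-top : ∀ t q → DegreeBelow q (suc t) → q ≈ₚ (take t q +ₚ (coeff q t ·ₚ monomial t))
  split-top t q q<1+t i = sym (begin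
    coeff (take t q +ₚ (qₜ ·ₚ monomial t)) i
      ≈⟨ coeff-+ₚ (take t q) _ i ⟩
    coeff (take t q) i + coeff (qₜ ·ₚ monomial t) i
      ≈⟨ +-cong refl (coeff-·ₚ qₜ (monomial t) i) ⟩
    coeff (take t q) i + qₜ * coeff (monomial t) i
      ≈⟨ byPosition (<-cmp i t) ⟩
    coeff q i ∎)
    where
    qₜ = coeff q t
    byPosition : Tri (i < t) (i ≡ t) (t < i) → (coeff (take t q) i + qₜ * coeff (monomial t) i) ≈ coeff q i
    byPosition (tri< i<t _ _) = trans
      (+-cong (reflexive (coeff-take-< t q i i<t)) (*-≈0ʳ qₜ (reflexive (coeff-monomial-< t i i<t))))
      (+-identityʳ _)
    byPosition (tri≈ _ ≡.refl _) = trans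
      (+-cong (take-degreeBelow t q t ≤-refl) (*-cong refl (reflexive (coeff-monomial-≡ t))))
      (trans (+-identityˡ _) (*-identityʳ qₜ))
    byPosition (tri> _ _ t<i) = trans
      (+-≈0 (take-degreeBelow t q i (<⇒≤ t<i)) (*-≈0ʳ qₜ (monomial-degreeBelow t i t<i)))
      (sym (q<1+t i t<i))

  *ₚ-X : ∀ a q → (a *ₚ X q) ≈ₚ X (a *ₚ q)
  *ₚ-X []      q zero    = refl
  *ₚ-X []      q (suc i) = refl
  *ₚ-X (b ∷ a) q zero    = +-≈0 (zeroʳ b) refl
  *ₚ-X (b ∷ a) q (suc i) = begin
    coeff ((b ·ₚ q) +ₚ (a *ₚ X q)) i        ≈⟨ coeff-+ₚ (b ·ₚ q) _ i ⟩
    coeff (b ·ₚ q) i + coeff (a *ₚ X q) i    ≈⟨ +-cong refl (*ₚ-X a q i) ⟩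
    coeff (b ·ₚ q) i + coeff (X (a *ₚ q)) i  ≈⟨ sym (coeff-+ₚ (b ·ₚ q) _ i) ⟩
    coeff ((b ·ₚ q) +ₚ X (a *ₚ q)) i        ∎

  *ₚ-one : ∀ a → (a *ₚ (1# ∷ [])) ≈ₚ a
  *ₚ-one []      i       = refl
  *ₚ-one (b ∷ a) zero    = trans (+-identityʳ _) (*-identityʳ b)
  *ₚ-one (b ∷ a) (suc i) = *ₚ-one a i

  *ₚ-monomial : ∀ m a → (a *ₚ monomial m) ≈ₚ iter X m a
  *ₚ-monomial zero    a = *ₚ-one a
  *ₚ-monomial (suc m) a zero    = *ₚ-X a (monomial m) zero
  *ₚ-monomial (suc m) a (suc i) = trans (*ₚ-X a (monomial m) (suc i)) (*ₚ-monomial m a i)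

  *ₚ-degreeBelow : ∀ a p k → (∀ i j → k ≤ i +ℕ j → (coeff a i * coeff p j) ≈ 0#) →
                   DegreeBelow (a *ₚ p) k
  *ₚ-degreeBelow []      p k _        i _   = refl
  *ₚ-degreeBelow (b ∷ a) p k aᵢpⱼ≈0 i k≤i =
    trans (coeff-+ₚ (b ·ₚ p) (X (a *ₚ p)) i)
          (+-≈0 (trans (coeff-·ₚ b p i) (aᵢpⱼ≈0 0 i k≤i)) (shifted i k≤i))
    where
    shifted : ∀ i → k ≤ i → coeff (X (a *ₚ p)) i ≈ 0#
    shifted zero    _     = refl
    shifted (suc i) k≤1+i =
      *ₚ-degreeBelow a p (pred k) (λ i j → aᵢpⱼ≈0 (suc i) j ∘ pred≤⇒≤suc k) i (pred-mono-≤ k≤1+i)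

  *ₚ-degreeBelow-length : ∀ a p k → (∀ i → k < i +ℕ length p → coeff a i ≈ 0#) →
                          DegreeBelow (a *ₚ p) k
  *ₚ-degreeBelow-length a p k aᵢ≈0 = *ₚ-degreeBelow a p k aᵢpⱼ≈0
    where
    aᵢpⱼ≈0 : ∀ i j → k ≤ i +ℕ j → (coeff a i * coeff p j) ≈ 0#
    aᵢpⱼ≈0 i j k≤i+j with length p ≤? j
    ... | yes l≤j = *-≈0ʳ _ (degreeBelow-length p j l≤j)
    ... | no  l≰j = *-≈0ˡ _ (aᵢ≈0 i (≤-<-trans k≤i+j (+-monoʳ-< i (≰⇒> l≰j))))

  EventuallyZero : (ℕ → Poly → Poly) → Set (c Level.⊔ ℓ)
  EventuallyZero T = ∀ p → ∃ λ N → ∀ k → N ≤ k → T k p ≈ₚ 0ₚ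

  converges⇔eventuallyZero : ∀ T → ConvergesDiscrete T ⇔ EventuallyZero T
  converges⇔eventuallyZero T = mk⇔ converges⇒eventuallyZero eventuallyZero⇒converges
    where
    converges⇒eventuallyZero : ConvergesDiscrete T → EventuallyZero T
    converges⇒eventuallyZero conv p with conv p
    ... | N , stable = N , λ k N≤k i → identityʳ-unique _ _ (begin
      coeff (partialSum T k p) i + coeff (T k p) i ≈⟨ sym (coeff-+ₚ (partialSum T k p) (T k p) i) ⟩
      coeff (partialSum T (suc k) p) i             ≈⟨ stable (suc k) (m≤n⇒m≤1+n N≤k) i ⟩
      coeff (partialSum T N p) i                   ≈⟨ sym (stable k N≤k i) ⟩
      coeff (partialSum T k p) i                   ∎)

    eventuallyZero⇒converges : EventuallyZero T → ConvergesDiscrete T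
    eventuallyZero⇒converges ev p with ev p
    ... | N , vanish = N , λ M N≤M →
      ≡.subst (λ M → partialSum T M p ≈ₚ partialSum T N p) (m∸n+n≡m N≤M) (stable (M ∸ N))
      where
      stable : ∀ d → partialSum T (d +ℕ N) p ≈ₚ partialSum T N p
      stable zero    i = refl
      stable (suc d) i = trans (coeff-+ₚ (partialSum T (d +ℕ N) p) _ i)
        (trans (+-cong (stable d i) (vanish (d +ℕ N) (m≤n+m N d) i)) (+-identityʳ _))

  iter-isLinear : ∀ {T} → IsLinear T → ∀ k → IsLinear (iter T k)
  iter-isLinear lin zero = record
    { cong = λ p≈q → p≈q ; additive = λ _ _ _ → refl ; homogeneous = λ _ _ _ → refl }
  iter-isLinear {T} lin (suc k) = record
    { cong        = λ {p} {q} p≈q → cong {iter T k p} {iter T k q} (Tᵏ.cong p≈q)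
    ; additive    = λ p q i → trans (cong {iter T k (p +ₚ q)} {iter T k p +ₚ iter T k q} (Tᵏ.additive p q) i)
                                    (additive (iter T k p) (iter T k q) i)
    ; homogeneous = λ a p i → trans (cong {iter T k (a ·ₚ p)} {a ·ₚ iter T k p} (Tᵏ.homogeneous a p) i)
                                    (homogeneous a (iter T k p) i)
    }
    where
    open IsLinear lin
    module Tᵏ = IsLinear (iter-isLinear lin k)

  linear-split-top : ∀ {T} → IsLinear T → ∀ t q → DegreeBelow q (suc t) → ∀ i →
    coeff (T q) i ≈ (coeff (T (take t q)) i + coeff q t * coeff (T (monomial t)) i)
  linear-split-top {T} lin t q q<1+t i = begin
    coeff (T q) i                                    ≈⟨ cong (split-top t q q<1+t) i ⟩
    coeff (T (take t q +ₚ (qₜ ·ₚ monomial t))) i      ≈⟨ additive _ _ i ⟩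
    coeff (T (take t q) +ₚ T (qₜ ·ₚ monomial t)) i    ≈⟨ coeff-+ₚ (T (take t q)) _ i ⟩
    coeff (T (take t q)) i + coeff (T (qₜ ·ₚ monomial t)) i
      ≈⟨ +-cong refl (trans (homogeneous qₜ _ i) (coeff-·ₚ qₜ (T (monomial t)) i)) ⟩
    coeff (T (take t q)) i + qₜ * coeff (T (monomial t)) i ∎
    where
    open IsLinear lin
    qₜ = coeff q t

  applySeries-iterX-monomial : ∀ f T k m →
    applySeries f T (iter X k (monomial m)) ≡ truncApply f T (suc (k +ℕ m)) (monomial (k +ℕ m))
  applySeries-iterX-monomial f T k m
    rewrite iterX-monomial k m | length-monomial (k +ℕ m) = ≡.refl

  ordAtLeast-suc : ∀ {f n} → OrdAtLeast f n → f n ≈ 0# → OrdAtLeast f (suc n)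
  ordAtLeast-suc ord≥n fₙ≈0 j j<1+n with m<1+n⇒m<n∨m≡n j<1+n
  ... | inj₁ j<n    = ord≥n j j<n
  ... | inj₂ ≡.refl = fₙ≈0

  coeff-truncApply≈0 : ∀ f T L p s → (∀ j → j < L → (f j * coeff (iter T j p) s) ≈ 0#) →
                       coeff (truncApply f T L p) s ≈ 0#
  coeff-truncApply≈0 f T zero    p s _        = refl
  coeff-truncApply≈0 f T (suc L) p s terms≈0 = trans (coeff-+ₚ (truncApply f T L p) _ s)
    (+-≈0 (coeff-truncApply≈0 f T L p s (λ j j<L → terms≈0 j (m<n⇒m<1+n j<L)))
          (trans (coeff-·ₚ (f L) (iter T L p) s) (terms≈0 L ≤-refl)))

  truncApply-ordAtLeast : ∀ f T L p → OrdAtLeast f L → truncApply f T L p ≈ₚ 0ₚ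
  truncApply-ordAtLeast f T L p ord≥L s =
    coeff-truncApply≈0 f T L p s (λ j j<L → *-≈0ˡ _ (ord≥L j j<L))

  coeff-truncApply-single : ∀ f T L p s J → J < L →
    (∀ j → j < L → ¬ (j ≡ J) → (f j * coeff (iter T j p) s) ≈ 0#) →
    coeff (truncApply f T L p) s ≈ (f J * coeff (iter T J p) s)
  coeff-truncApply-single f T (suc L) p s J J<1+L others≈0
    with m<1+n⇒m<n∨m≡n J<1+L
  ... | inj₁ J<L = trans (coeff-+ₚ (truncApply f T L p) _ s)
    (trans (+-cong (coeff-truncApply-single f T L p s J J<L (λ j j<L → others≈0 j (m<n⇒m<1+n j<L)))
                   (trans (coeff-·ₚ (f L) (iter T L p) s)
                          (others≈0 L ≤-refl (λ L≡J → <-irrefl (≡.sym L≡J) J<L))))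
           (+-identityʳ _))
  ... | inj₂ ≡.refl = trans (coeff-+ₚ (truncApply f T L p) _ s)
    (trans (+-cong (coeff-truncApply≈0 f T L p s
                      (λ j j<L → others≈0 j (m<n⇒m<1+n j<L) (λ j≡L → <-irrefl j≡L j<L)))
                   (coeff-·ₚ (f L) (iter T L p) s))
           (+-identityˡ _))

  module LoweringOperator {B : Poly → Poly} (lin : IsLinear B) (low : LowersDegree B) where

    B-degreeBelow : ∀ n q → DegreeBelow q (suc n) → DegreeBelow (B q) n
    B-degreeBelow zero    q q<1     i _       = proj₂ low q q<1 i
    B-degreeBelow (suc n) q q<2+n i 1+n≤i = begin
      coeff (B q) i
        ≈⟨ linear-split-top lin (suc n) q q<2+n i ⟩
      coeff (B (take (suc n) q)) i + coeff q (suc n) * coeff (B (monomial (suc n))) i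
        ≈⟨ +-≈0 (B-degreeBelow n _ (take-degreeBelow (suc n) q) i (<⇒≤ 1+n≤i))
                (*-≈0ʳ _ (proj₂ (proj₁ low _ n (monomial-hasDegree (suc n))) i 1+n≤i)) ⟩
      0# ∎

    iterB-degreeBelow : ∀ j n q → DegreeBelow q (j +ℕ n) → DegreeBelow (iter B j q) n
    iterB-degreeBelow zero    n q q<n   = q<n
    iterB-degreeBelow (suc j) n q q<1+j+n = B-degreeBelow n (iter B j q)
      (iterB-degreeBelow j (suc n) q (≡.subst (DegreeBelow q) (≡.sym (+-suc j n)) q<1+j+n))

    iterB-annihilates : ∀ k q → DegreeBelow q k → iter B k q ≈ₚ 0ₚ
    iterB-annihilates k q q<k i =
      iterB-degreeBelow k 0 q (≡.subst (DegreeBelow q) (≡.sym (+ℕ-identityʳ k)) q<k) i z≤n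

    iterB-monomial-hasDegree : ∀ j s → HasDegree (iter B j (monomial (j +ℕ s))) s
    iterB-monomial-hasDegree zero    s = monomial-hasDegree s
    iterB-monomial-hasDegree (suc j) s = proj₁ low _ s
      (≡.subst (λ n → HasDegree (iter B j (monomial n)) (suc s)) (+-suc j s)
               (iterB-monomial-hasDegree j (suc s)))

    coeff-iterB-top : ∀ k s q → DegreeBelow q (suc (k +ℕ s)) →
      coeff (iter B k q) s ≈ (coeff q (k +ℕ s) * coeff (iter B k (monomial (k +ℕ s))) s)
    coeff-iterB-top k s q q<1+k+s = begin
      coeff (iter B k q) s
        ≈⟨ linear-split-top (iter-isLinear lin k) (k +ℕ s) q q<1+k+s s ⟩
      coeff (iter B k (take (k +ℕ s) q)) s + coeff q (k +ℕ s) * coeff (iter B k (monomial (k +ℕ s))) s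
        ≈⟨ +-cong (iterB-degreeBelow k s _ (take-degreeBelow (k +ℕ s) q) s ≤-refl) refl ⟩
      0# + coeff q (k +ℕ s) * coeff (iter B k (monomial (k +ℕ s))) s
        ≈⟨ +-identityˡ _ ⟩
      coeff q (k +ℕ s) * coeff (iter B k (monomial (k +ℕ s))) s ∎

    iterB≈0⇒degreeBelow : ∀ k q → iter B k q ≈ₚ 0ₚ → DegreeBelow q k
    iterB≈0⇒degreeBelow k q Bᵏq≈0 =
      lower (length q) (degreeBelow-mono q (m≤n+m (length q) k) (degreeBelow-length q))
      where
      lower : ∀ g → DegreeBelow q (k +ℕ g) → DegreeBelow q k
      lower zero    q<k+0   = ≡.subst (DegreeBelow q) (+ℕ-identityʳ k) q<k+0
      lower (suc g) q<k+1+g = lower g (degreeBelow-lower q q<1+k+g top≈0)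
        where
        q<1+k+g : DegreeBelow q (suc (k +ℕ g))
        q<1+k+g = ≡.subst (DegreeBelow q) (+-suc k g) q<k+1+g
        top≈0 : coeff q (k +ℕ g) ≈ 0#
        top≈0 = x*y≈0⇒x≈0 _ _
          (trans (sym (coeff-iterB-top k g q q<1+k+g)) (Bᵏq≈0 g))
          (proj₁ (iterB-monomial-hasDegree k g))

    coeff-truncApply-monomial : ∀ f n J → J ≤ n → OrdAtLeast f J →
      coeff (truncApply f B (suc n) (monomial n)) (n ∸ J)
        ≈ (f J * coeff (iter B J (monomial n)) (n ∸ J))
    coeff-truncApply-monomial f n J J≤n ord≥J =
      coeff-truncApply-single f B (suc n) (monomial n) s J (s≤s J≤n) others≈0
      where
      s = n ∸ J
      J+s≡n : J +ℕ s ≡ n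
      J+s≡n = m+[n∸m]≡n J≤n
      others≈0 : ∀ j → j < suc n → ¬ (j ≡ J) → (f j * coeff (iter B j (monomial n)) s) ≈ 0#
      others≈0 j _ j≢J with <-cmp j J
      ... | tri< j<J _ _ = *-≈0ˡ _ (ord≥J j j<J)
      ... | tri≈ _ j≡J _ = ⊥-elim (j≢J j≡J)
      ... | tri> _ _ J<j = *-≈0ʳ _ (iterB-degreeBelow j s (monomial n)
              (degreeBelow-mono (monomial n) (≡.subst (λ m → suc m ≤ j +ℕ s) J+s≡n (+-monoˡ-≤ s J<j))
                                (monomial-degreeBelow n)) s ≤-refl)

    truncApply-monomial≈0⇒ordAtLeast : ∀ f n → truncApply f B (suc n) (monomial n) ≈ₚ 0ₚ →
                                        OrdAtLeast f (suc n)
    truncApply-monomial≈0⇒ordAtLeast f n fBxⁿ≈0 = ordAtLeast (suc n) ≤-refl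
      where
      ordAtLeast : ∀ J → J ≤ suc n → OrdAtLeast f J
      ordAtLeast zero    _         j ()
      ordAtLeast (suc J) (s≤s J≤n) = ordAtLeast-suc ord≥J (x*y≈0⇒x≈0 _ _
          (trans (sym (coeff-truncApply-monomial f n J J≤n ord≥J)) (fBxⁿ≈0 (n ∸ J)))
          (proj₁ (≡.subst (λ m → HasDegree (iter B J (monomial m)) (n ∸ J)) (m+[n∸m]≡n J≤n)
                          (iterB-monomial-hasDegree J (n ∸ J)))))
        where
        ord≥J : OrdAtLeast f J
        ord≥J = ordAtLeast J (m≤n⇒m≤1+n J≤n)

    iterB[a*xᵐ]≈0⇒coeff≈0 : ∀ k m a → iter B k (a *ₚ monomial m) ≈ₚ 0ₚ →
                             ∀ i → k < i +ℕ m → coeff a i ≈ 0#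
    iterB[a*xᵐ]≈0⇒coeff≈0 k m a Bᵏ[axᵐ]≈0 i k<i+m = begin
      coeff a i                  ≈⟨ sym (reflexive (coeff-iterX m a i)) ⟩
      coeff (iter X m a) (m +ℕ i) ≈⟨ iterB≈0⇒degreeBelow k (iter X m a) Bᵏ[xᵐa]≈0 (m +ℕ i) k≤m+i ⟩
      0#                         ∎
      where
      Bᵏ[xᵐa]≈0 : iter B k (iter X m a) ≈ₚ 0ₚ
      Bᵏ[xᵐa]≈0 j = trans
        (IsLinear.cong (iter-isLinear lin k) {iter X m a} {a *ₚ monomial m}
                       (sym ∘ *ₚ-monomial m a) j)
        (Bᵏ[axᵐ]≈0 j)
      k≤m+i : k ≤ m +ℕ i
      k≤m+i = ≤-trans (<⇒≤ k<i+m) (≤-reflexive (+ℕ-comm i m))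

    fₖ[B]Xᵏ-converges⇔ : ∀ (f : ℕ → PowerSeries) →
      ConvergesDiscrete (λ k p → applySeries (f k) B (iter X k p)) ⇔ OrdMinusIndexToInfinity f
    fₖ[B]Xᵏ-converges⇔ f = ⇔.trans (converges⇔eventuallyZero T) (mk⇔ to from)
      where
      T : ℕ → Poly → Poly
      T k p = applySeries (f k) B (iter X k p)
      to : EventuallyZero T → OrdMinusIndexToInfinity f
      to ev m with ev (monomial m)
      ... | N , vanish = N , λ k N≤k j j<k+m →
        truncApply-monomial≈0⇒ordAtLeast (f k) (k +ℕ m)
          (≡.subst (_≈ₚ 0ₚ) (applySeries-iterX-monomial (f k) B k m) (vanish k N≤k))
          j (m<n⇒m<1+n j<k+m)
      from : OrdMinusIndexToInfinity f → EventuallyZero T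
      from ord p with ord (length p)
      ... | N , ord≥ = N , λ k N≤k → truncApply-ordAtLeast (f k) B _ (iter X k p)
        (≡.subst (OrdAtLeast (f k)) (≡.sym (length-iterX k p)) (ord≥ k N≤k))

    Bᵏaₖ[X]-converges⇔ : ∀ (a : ℕ → Poly) →
      ConvergesDiscrete (λ k p → iter B k (mulOp (a k) p)) ⇔ IndexMinusDegToInfinity a
    Bᵏaₖ[X]-converges⇔ a = ⇔.trans (converges⇔eventuallyZero T) (mk⇔ to from)
      where
      T : ℕ → Poly → Poly
      T k p = iter B k (mulOp (a k) p)
      to : EventuallyZero T → IndexMinusDegToInfinity a
      to ev m with ev (monomial m)
      ... | N , vanish = N , λ k N≤k → iterB[a*xᵐ]≈0⇒coeff≈0 k m (a k) (vanish k N≤k)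
      from : IndexMinusDegToInfinity a → EventuallyZero T
      from deg p with deg (length p)
      ... | N , aₖ-small = N , λ k N≤k →
        iterB-annihilates k (a k *ₚ p) (*ₚ-degreeBelow-length (a k) p k (aₖ-small k N≤k))

mainTheorem7 : ∀ {c ℓ : Level} (K : Field c ℓ) → let open FieldDefs K in
    CharZero → (B : Poly → Poly) → IsLinear B → LowersDegree B →
    ((f : ℕ → PowerSeries) →
    ConvergesDiscrete (λ k p → applySeries (f k) B (iter X k p)) ⇔ OrdMinusIndexToInfinity f)
    × ((a : ℕ → Poly) →
    ConvergesDiscrete (λ k p → iter B k (mulOp (a k) p)) ⇔ IndexMinusDegToInfinity a)
mainTheorem7 K _ B lin low = fₖ[B]Xᵏ-converges⇔ , Bᵏaₖ[X]-converges⇔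
  where open Development.LoweringOperator K lin low
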